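{- Let the polynomials $\tilde F_n(z)$ be defined by $\tilde F_1(z)=1$ and $\tilde F_{n+1}(z)=z(z+1)\tilde F_n(z+1)-(z-1)z\tilde F_n(z)$ for $n\geq1$. Let $(H_{2n-1})_{n\geq1}$ be the median Genocchi numbers (Genocchi numbers of the second kind) and let $Ls(m,j)$ be the Legendre–Stirling numbers of the first kind. Then for all integers $n\geq1$ and $m\geq0$, \[ \sum_{j=0}^{m}(-1)^{m+j}Ls(m,j)H_{2n+2j-1}=\tilde F_n(m+1)\,m!\,(m+1)!. \]
   Context: Seidel triangle: numbers $g_{n,j}$ for $j\geq1$, $1\leq n\leq (j+1)/2$ (and $g_{n,j}=0$ outside this range), with $g_{1,1}=1$, $g_{n,2j}=\sum_{q\geq n}g_{q,2j-1}$, $g_{n,2j+1}=\sum_{q\leq n}g_{q,2j}$. The median Genocchi numbers are $H_{2n-1}=g_{1,2n}$ ($1,2,8,56,\dots$). Stirling type numbers of the first kind for a sequence $(a_n)_{n\geq1}$: $t(n+1,j)=t(n,j-1)-a_nt(n,j)$, $t(n,0)=\delta_{n,0}$, $t(n,j)=0$ for $n<j$. The Legendre–Stirling numbers of the first kind $Ls(n,j)$ are these numbers for $a_n=n(n+1)$. -}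

module Defs where

open import Data.Nat as ℕ using (ℕ; zero; suc; _≤ᵇ_; _≡ᵇ_; ⌊_/2⌋; _%_)
open import Data.Bool using (Bool; true; false; if_then_else_; _∧_)
open import Data.Integer as ℤ using (ℤ; +_; -1ℤ)

-- Σ_{q=a}^{b} f q  (natural-number valued), empty if b < a
sumℕ : ℕ → ℕ → (ℕ → ℕ) → ℕ
sumℕ a zero    f = if a ≡ᵇ 0 then f 0 else 0
sumℕ a (suc b) f = sumℕ a b f ℕ.+ (if a ≤ᵇ suc b then f (suc b) else 0)

sumℤ : ℕ → (ℕ → ℤ) → ℤ
sumℤ zero    f = f 0
sumℤ (suc m) f = sumℤ m f ℤ.+ f (suc m)

-- 1 ≤ n ≤ (j+1)/2  (the support of the j-th column of the Seidel triangle)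
inRange : ℕ → ℕ → Bool
inRange j n = (1 ≤ᵇ n) ∧ (n ≤ᵇ ⌊ suc j /2⌋)

-- seidelCol j n = g_{n,j}; g_{n,j} = 0 outside j ≥ 1, 1 ≤ n ≤ (j+1)/2.
seidelCol : ℕ → ℕ → ℕ
seidelCol zero n = 0
seidelCol (suc zero) n = if n ≡ᵇ 1 then 1 else 0
seidelCol (suc (suc k)) n =
  if inRange (suc (suc k)) n
  then (if (k % 2) ≡ᵇ 0
        -- column 2j = k+2 :  g_{n,2j} = Σ_{q ≥ n} g_{q,2j-1}
        then sumℕ n (suc k) (seidelCol (suc k))
        -- column 2j+1 = k+2 :  g_{n,2j+1} = Σ_{q ≤ n} g_{q,2j}
        else sumℕ 1 n (seidelCol (suc k)))
  else 0

g : ℕ → ℕ → ℕ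
g n j = seidelCol j n

-- median Genocchi numbers:  H k = H_{2k-1} = g_{1,2k}  (k ≥ 1)
H : ℕ → ℕ
H k = g 1 (2 ℕ.* k)

stirling1 : (ℕ → ℤ) → ℕ → ℕ → ℤ
stirling1 a zero    zero    = + 1
stirling1 a zero    (suc j) = + 0
stirling1 a (suc n) zero    = ℤ.- (a n ℤ.* stirling1 a n zero)
stirling1 a (suc n) (suc j) = stirling1 a n j ℤ.- a n ℤ.* stirling1 a n (suc j)

Ls : ℕ → ℕ → ℤ
Ls = stirling1 (λ n → + (n ℕ.* suc n))

-- F̃_n(z), as a function ℤ → ℤ (only n ≥ 1 is meaningful; F̃ 0 = 0 is a dummy)
F̃ : ℕ → ℤ → ℤ
F̃ zero z = + 0
F̃ (suc zero) z = + 1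
F̃ (suc (suc n)) z =
  z ℤ.* (z ℤ.+ + 1) ℤ.* F̃ (suc n) (z ℤ.+ + 1) ℤ.- (z ℤ.- + 1) ℤ.* z ℤ.* F̃ (suc n) z

module Submission where

-- With ℓ F(z) = z(z+1)F(z+1) − (z−1)zF(z) we have F̃ₙ₊₁ = ℓⁿ1. Split ℓ = β + δ, where
-- β F(z) = z²F(z+1) − (z−1)²F(z) and δ F(z) = zF(z+1) − (z−1)F(z). Then δβ = ℓδ + β,
-- δ1 = 1 and βF(1) = δF(1), which are exactly the boustrophedon rules of the Seidel
-- triangle: g(b+1, 2m+2) = (ℓᵃβᵇ1)(1) and g(b+1, 2m+3) = (ℓᵃδβᵇ1)(1) whenever a + b = m,
-- so H₂ₙ₋₁ = F̃ₙ(1). The left-hand side is the Legendre–Stirling transform of the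
-- sequence j ↦ H₂ₙ₊₂ⱼ₋₁, and any X(n, m) with X(n, m+1) = X(n+1, m) + m(m+1) X(n, m) is
-- the transform of its column X(n + j, 0); the right-hand side satisfies this recurrence
-- by the defining recursion of F̃.

open import Defs
open import Data.Nat using (ℕ; suc; _≤_; _!)
open import Data.Nat as ℕ using ()
open import Data.Integer using (ℤ; +_; -1ℤ; _*_; _^_)
open import Relation.Binary.PropositionalEquality using (_≡_)

open import Data.Nat using (zero; z≤n; s≤s; _<_; _≤ᵇ_; ⌊_/2⌋; _%_)
open import Data.Nat.Properties as ℕ using (_≤?_)
open import Data.Nat.DivMod using ([m+kn]%n≡m%n; m*n%n≡0)
open import Data.Integer using (_+_; _-_; -_)
open import Data.Integer.Properties as ℤ using ()
open import Data.Integer.Tactic.RingSolver using (solve-∀)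
open import Data.Nat.Tactic.RingSolver using () renaming (solve-∀ to ℕ-solve-∀)
open import Algebra.Properties.CommutativeSemigroup ℤ.+-commutativeSemigroup
  using () renaming (interchange to +-interchange)
open import Data.Bool using (true; false)
open import Data.Bool.Properties using (∧-zeroʳ)
open import Data.Sum using (inj₁; inj₂)
open import Function using (const)
open import Relation.Nullary.Decidable using (dec-true; dec-false)
open import Relation.Binary.PropositionalEquality
  using (_≗_; refl; sym; trans; cong; cong₂; module ≡-Reasoning)
open ≡-Reasoning

ℓ β δ : (ℤ → ℤ) → ℤ → ℤ
ℓ F z = z * (z + + 1) * F (z + + 1) - (z - + 1) * z * F z
β F z = z * z * F (z + + 1) - (z - + 1) * (z - + 1) * F z
δ F z = z * F (z + + 1) - (z - + 1) * F z

ℓ-cong : ∀ {F G} → F ≗ G → ℓ F ≗ ℓ G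
ℓ-cong {F} {G} F≗G z =
  cong₂ (λ u v → z * (z + + 1) * u - (z - + 1) * z * v) (F≗G (z + + 1)) (F≗G z)

ℓ-+ : ∀ F G → ℓ (λ z → F z + G z) ≗ λ z → ℓ F z + ℓ G z
ℓ-+ F G z = identity z (F z) (F (z + + 1)) (G z) (G (z + + 1))
  where
  identity : ∀ z f₀ f₁ g₀ g₁ →
    z * (z + + 1) * (f₁ + g₁) - (z - + 1) * z * (f₀ + g₀)
      ≡ (z * (z + + 1) * f₁ - (z - + 1) * z * f₀) + (z * (z + + 1) * g₁ - (z - + 1) * z * g₀)
  identity = solve-∀

ℓ≗β+δ : ∀ F → ℓ F ≗ λ z → β F z + δ F z
ℓ≗β+δ F z = identity z (F z) (F (z + + 1))
  where
  identity : ∀ z f₀ f₁ →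
    z * (z + + 1) * f₁ - (z - + 1) * z * f₀
      ≡ (z * z * f₁ - (z - + 1) * (z - + 1) * f₀) + (z * f₁ - (z - + 1) * f₀)
  identity = solve-∀

δβ≗ℓδ+β : ∀ F → δ (β F) ≗ λ z → ℓ (δ F) z + β F z
δβ≗ℓδ+β F z = identity z (F z) (F (z + + 1)) (F (z + + 1 + + 1))
  where
  identity : ∀ z f₀ f₁ f₂ →
    z * ((z + + 1) * (z + + 1) * f₂ - (z + + 1 - + 1) * (z + + 1 - + 1) * f₁)
      - (z - + 1) * (z * z * f₁ - (z - + 1) * (z - + 1) * f₀)
      ≡ (z * (z + + 1) * ((z + + 1) * f₂ - (z + + 1 - + 1) * f₁)
          - (z - + 1) * z * (z * f₁ - (z - + 1) * f₀))
        + (z * z * f₁ - (z - + 1) * (z - + 1) * f₀)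
  identity = solve-∀

δ-const-1 : δ (const (+ 1)) ≗ const (+ 1)
δ-const-1 = identity
  where
  identity : ∀ z → z * + 1 - (z - + 1) * + 1 ≡ + 1
  identity = solve-∀

β-at-1 : ∀ F → β F (+ 1) ≡ δ F (+ 1)
β-at-1 F = identity (F (+ 1)) (F (+ 1 + + 1))
  where
  identity : ∀ f₀ f₁ →
    + 1 * + 1 * f₁ - (+ 1 - + 1) * (+ 1 - + 1) * f₀ ≡ + 1 * f₁ - (+ 1 - + 1) * f₀
  identity = solve-∀

βⁿ1 : ℕ → ℤ → ℤ
βⁿ1 zero    = const (+ 1)
βⁿ1 (suc b) = β (βⁿ1 b)

Φ Ω : ℕ → ℕ → ℤ → ℤ
Φ zero    b = βⁿ1 b
Φ (suc a) b = ℓ (Φ a b)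
Ω zero    b = δ (βⁿ1 b)
Ω (suc a) b = ℓ (Ω a b)

Ω-zero : ∀ a → Ω a 0 ≗ Φ a 0
Ω-zero zero    = δ-const-1
Ω-zero (suc a) = ℓ-cong (Ω-zero a)

Φ-suc : ∀ a b → Φ (suc a) b ≗ λ z → Φ a (suc b) z + Ω a b z
Φ-suc zero    b   = ℓ≗β+δ (βⁿ1 b)
Φ-suc (suc a) b z = trans (ℓ-cong (Φ-suc a b) z) (ℓ-+ (Φ a (suc b)) (Ω a b) z)

Ω-suc : ∀ a b → Ω a (suc b) ≗ λ z → Ω (suc a) b z + Φ a (suc b) z
Ω-suc zero    b   = δβ≗ℓδ+β (βⁿ1 b)
Ω-suc (suc a) b z = trans (ℓ-cong (Ω-suc a b) z) (ℓ-+ (Ω (suc a) b) (Φ a (suc b)) z)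

Φ-at-1 : ∀ b → Φ 0 (suc b) (+ 1) ≡ Ω 0 b (+ 1)
Φ-at-1 b = β-at-1 (βⁿ1 b)

F̃≗Φ : ∀ n → F̃ (suc n) ≗ Φ n 0
F̃≗Φ zero    z = refl
F̃≗Φ (suc n) = ℓ-cong (F̃≗Φ n)

≤ᵇ-true : ∀ {m n} → m ≤ n → (m ≤ᵇ n) ≡ true
≤ᵇ-true {m} {n} = dec-true (m ≤? n)

≤ᵇ-false : ∀ {m n} → n < m → (m ≤ᵇ n) ≡ false
≤ᵇ-false {m} {n} n<m = dec-false (m ≤? n) (ℕ.<⇒≱ n<m)

sumℕ-empty : ∀ {a} b f → b < a → sumℕ a b f ≡ 0
sumℕ-empty {suc a} zero    f b<a = refl
sumℕ-empty {a}     (suc b) f b<a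
  rewrite sumℕ-empty b f (ℕ.<-trans (ℕ.n<1+n b) b<a) | ≤ᵇ-false b<a = refl

sumℕ-vanishing : ∀ a b f → (∀ q → a ≤ q → f q ≡ 0) → sumℕ a b f ≡ 0
sumℕ-vanishing zero    zero    f f≡0 = f≡0 0 z≤n
sumℕ-vanishing (suc a) zero    f f≡0 = refl
sumℕ-vanishing a       (suc b) f f≡0 with ℕ.≤-<-connex a (suc b)
... | inj₁ a≤1+b rewrite sumℕ-vanishing a b f f≡0 | ≤ᵇ-true a≤1+b = f≡0 (suc b) a≤1+b
... | inj₂ b<a rewrite sumℕ-vanishing a b f f≡0 | ≤ᵇ-false b<a = refl

sumℕ-from : ∀ {a} b f → a ≤ b → sumℕ a b f ≡ f a ℕ.+ sumℕ (suc a) b f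
sumℕ-from zero f z≤n = sym (ℕ.+-identityʳ (f 0))
sumℕ-from {a} (suc b) f a≤1+b with ℕ.m≤n⇒m<n∨m≡n a≤1+b
... | inj₂ refl
  rewrite sumℕ-empty b f (ℕ.n<1+n b) | ≤ᵇ-true (ℕ.≤-refl {suc b})
        | sumℕ-empty (suc b) f (ℕ.n<1+n (suc b)) = ℕ.+-comm 0 (f (suc b))
... | inj₁ (s≤s a≤b)
  rewrite sumℕ-from b f a≤b | ≤ᵇ-true a≤1+b | ≤ᵇ-true (s≤s a≤b)
  = ℕ.+-assoc (f a) (sumℕ (suc a) b f) (f (suc b))

⌊2m/2⌋≡m : ∀ m → ⌊ 2 ℕ.* m /2⌋ ≡ m
⌊2m/2⌋≡m zero    = refl
⌊2m/2⌋≡m (suc m) = trans (cong ⌊_/2⌋ (ℕ.*-suc 2 m)) (cong suc (⌊2m/2⌋≡m m))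

⌊1+2m/2⌋≡m : ∀ m → ⌊ suc (2 ℕ.* m) /2⌋ ≡ m
⌊1+2m/2⌋≡m zero    = refl
⌊1+2m/2⌋≡m (suc m) = trans (cong (λ k → ⌊ suc k /2⌋) (ℕ.*-suc 2 m)) (cong suc (⌊1+2m/2⌋≡m m))

2m%2≡0 : ∀ m → (2 ℕ.* m) % 2 ≡ 0
2m%2≡0 m rewrite ℕ.*-comm 2 m = m*n%n≡0 m 2

1+2m%2≡1 : ∀ m → suc (2 ℕ.* m) % 2 ≡ 1
1+2m%2≡1 m rewrite ℕ.*-comm 2 m = [m+kn]%n≡m%n 1 m 2

m≤1+2m : ∀ m → m ≤ suc (2 ℕ.* m)
m≤1+2m m = ℕ.m≤n⇒m≤1+n (ℕ.m≤m+n m (m ℕ.+ 0))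

evenColumn oddColumn : ℕ → ℕ → ℕ
evenColumn m = seidelCol (2 ℕ.+ 2 ℕ.* m)
oddColumn  m = seidelCol (3 ℕ.+ 2 ℕ.* m)

evenColumn-sum : ∀ m {q} → 1 ≤ q → q ≤ suc m →
  evenColumn m q ≡ sumℕ q (suc (2 ℕ.* m)) (seidelCol (suc (2 ℕ.* m)))
evenColumn-sum m 1≤q q≤1+m rewrite ⌊1+2m/2⌋≡m m | ≤ᵇ-true 1≤q | ≤ᵇ-true q≤1+m | 2m%2≡0 m = refl

evenColumn-vanishing : ∀ m {q} → suc m < q → evenColumn m q ≡ 0
evenColumn-vanishing m {q} 1+m<q
  rewrite ⌊1+2m/2⌋≡m m | ≤ᵇ-false 1+m<q | ∧-zeroʳ (1 ≤ᵇ q) = refl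

oddColumn-sum : ∀ m {q} → 1 ≤ q → q ≤ 2 ℕ.+ m → oddColumn m q ≡ sumℕ 1 q (evenColumn m)
oddColumn-sum m 1≤q q≤2+m rewrite ⌊2m/2⌋≡m m | ≤ᵇ-true 1≤q | ≤ᵇ-true q≤2+m | 1+2m%2≡1 m = refl

oddColumn-vanishing : ∀ m {q} → 2 ℕ.+ m < q → oddColumn m q ≡ 0
oddColumn-vanishing m {q} 2+m<q
  rewrite ⌊2m/2⌋≡m m | ≤ᵇ-false 2+m<q | ∧-zeroʳ (1 ≤ᵇ q) = refl

evenColumn-suc-sum : ∀ m {q} → 1 ≤ q → q ≤ 2 ℕ.+ m →
  evenColumn (suc m) q ≡ sumℕ q (3 ℕ.+ 2 ℕ.* m) (oddColumn m)
evenColumn-suc-sum m {q} 1≤q q≤2+m = trans (evenColumn-sum (suc m) 1≤q q≤2+m)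
  (cong (λ k → sumℕ q (suc k) (seidelCol (suc k))) (ℕ.*-suc 2 m))

oddColumn-1 : ∀ m → oddColumn m 1 ≡ evenColumn m 1
oddColumn-1 m = oddColumn-sum m (s≤s z≤n) (s≤s z≤n)

oddColumn-suc : ∀ m {b} → b ≤ m →
  oddColumn m (2 ℕ.+ b) ≡ oddColumn m (suc b) ℕ.+ evenColumn m (2 ℕ.+ b)
oddColumn-suc m {b} b≤m = trans (oddColumn-sum m (s≤s z≤n) (s≤s (s≤s b≤m)))
  (cong (ℕ._+ evenColumn m (2 ℕ.+ b)) (sym (oddColumn-sum m (s≤s z≤n) (s≤s (ℕ.m≤n⇒m≤1+n b≤m)))))

oddColumn-last : ∀ m → oddColumn m (2 ℕ.+ m) ≡ oddColumn m (suc m)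
oddColumn-last m = begin
  oddColumn m (2 ℕ.+ m)                             ≡⟨ oddColumn-suc m ℕ.≤-refl ⟩
  oddColumn m (suc m) ℕ.+ evenColumn m (2 ℕ.+ m)    ≡⟨ cong (oddColumn m (suc m) ℕ.+_) (evenColumn-vanishing m ℕ.≤-refl) ⟩
  oddColumn m (suc m) ℕ.+ 0                         ≡⟨ ℕ.+-identityʳ _ ⟩
  oddColumn m (suc m)                               ∎

evenColumn-suc : ∀ m {b} → b ≤ m →
  evenColumn (suc m) (suc b) ≡ oddColumn m (suc b) ℕ.+ evenColumn (suc m) (2 ℕ.+ b)
evenColumn-suc m {b} b≤m = begin
  evenColumn (suc m) (suc b)
    ≡⟨ evenColumn-suc-sum m (s≤s z≤n) (ℕ.m≤n⇒m≤1+n (s≤s b≤m)) ⟩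
  sumℕ (suc b) (3 ℕ.+ 2 ℕ.* m) (oddColumn m)
    ≡⟨ sumℕ-from (3 ℕ.+ 2 ℕ.* m) (oddColumn m) (s≤s (ℕ.≤-trans b≤m (ℕ.m≤n⇒m≤1+n (m≤1+2m m)))) ⟩
  oddColumn m (suc b) ℕ.+ sumℕ (2 ℕ.+ b) (3 ℕ.+ 2 ℕ.* m) (oddColumn m)
    ≡⟨ cong (oddColumn m (suc b) ℕ.+_) (sym (evenColumn-suc-sum m (s≤s z≤n) (s≤s (s≤s b≤m)))) ⟩
  oddColumn m (suc b) ℕ.+ evenColumn (suc m) (2 ℕ.+ b) ∎

evenColumn-last : ∀ m → evenColumn (suc m) (2 ℕ.+ m) ≡ oddColumn m (2 ℕ.+ m)
evenColumn-last m = begin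
  evenColumn (suc m) (2 ℕ.+ m)
    ≡⟨ evenColumn-suc-sum m (s≤s z≤n) ℕ.≤-refl ⟩
  sumℕ (2 ℕ.+ m) (3 ℕ.+ 2 ℕ.* m) (oddColumn m)
    ≡⟨ sumℕ-from (3 ℕ.+ 2 ℕ.* m) (oddColumn m) (s≤s (s≤s (m≤1+2m m))) ⟩
  oddColumn m (2 ℕ.+ m) ℕ.+ sumℕ (3 ℕ.+ m) (3 ℕ.+ 2 ℕ.* m) (oddColumn m)
    ≡⟨ cong (oddColumn m (2 ℕ.+ m) ℕ.+_) (sumℕ-vanishing (3 ℕ.+ m) (3 ℕ.+ 2 ℕ.* m) (oddColumn m) (λ q → oddColumn-vanishing m)) ⟩
  oddColumn m (2 ℕ.+ m) ℕ.+ 0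
    ≡⟨ ℕ.+-identityʳ _ ⟩
  oddColumn m (2 ℕ.+ m) ∎

right-summand-≤ : ∀ a {b m} → a ℕ.+ b ≡ m → b ≤ m
right-summand-≤ a refl = ℕ.m≤n+m _ a

EvenColumnIsΦ OddColumnIsΩ : ℕ → Set
EvenColumnIsΦ m = ∀ a b → a ℕ.+ b ≡ m → + evenColumn m (suc b) ≡ Φ a b (+ 1)
OddColumnIsΩ  m = ∀ a b → a ℕ.+ b ≡ m → + oddColumn  m (suc b) ≡ Ω a b (+ 1)

oddColumnIsΩ : ∀ m → EvenColumnIsΦ m → OddColumnIsΩ m
oddColumnIsΩ m even a zero a+0≡m = begin
  + oddColumn m 1    ≡⟨ cong +_ (oddColumn-1 m) ⟩
  + evenColumn m 1   ≡⟨ even a 0 a+0≡m ⟩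
  Φ a 0 (+ 1)        ≡⟨ Ω-zero a (+ 1) ⟨
  Ω a 0 (+ 1)        ∎
oddColumnIsΩ m even a (suc b) a+1+b≡m = begin
  + oddColumn m (2 ℕ.+ b)
    ≡⟨ cong +_ (oddColumn-suc m (ℕ.<⇒≤ (right-summand-≤ a a+1+b≡m))) ⟩
  + (oddColumn m (suc b) ℕ.+ evenColumn m (2 ℕ.+ b))
    ≡⟨ ℤ.pos-+ (oddColumn m (suc b)) (evenColumn m (2 ℕ.+ b)) ⟩
  + oddColumn m (suc b) + + evenColumn m (2 ℕ.+ b)
    ≡⟨ cong₂ _+_ (oddColumnIsΩ m even (suc a) b (trans (sym (ℕ.+-suc a b)) a+1+b≡m))
                 (even a (suc b) a+1+b≡m) ⟩
  Ω (suc a) b (+ 1) + Φ a (suc b) (+ 1)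
    ≡⟨ Ω-suc a b (+ 1) ⟨
  Ω a (suc b) (+ 1) ∎

evenColumnIsΦ-suc : ∀ m → OddColumnIsΩ m → EvenColumnIsΦ (suc m)
evenColumnIsΦ-suc m odd zero .(suc m) refl = begin
  + evenColumn (suc m) (2 ℕ.+ m)   ≡⟨ cong +_ (evenColumn-last m) ⟩
  + oddColumn m (2 ℕ.+ m)          ≡⟨ cong +_ (oddColumn-last m) ⟩
  + oddColumn m (suc m)            ≡⟨ odd 0 m refl ⟩
  Ω 0 m (+ 1)                      ≡⟨ Φ-at-1 m ⟨
  Φ 0 (suc m) (+ 1)                ∎
evenColumnIsΦ-suc m odd (suc a) b 1+a+b≡1+m = begin
  + evenColumn (suc m) (suc b)
    ≡⟨ cong +_ (evenColumn-suc m (right-summand-≤ a a+b≡m)) ⟩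
  + (oddColumn m (suc b) ℕ.+ evenColumn (suc m) (2 ℕ.+ b))
    ≡⟨ ℤ.pos-+ (oddColumn m (suc b)) (evenColumn (suc m) (2 ℕ.+ b)) ⟩
  + oddColumn m (suc b) + + evenColumn (suc m) (2 ℕ.+ b)
    ≡⟨ cong₂ _+_ (odd a b a+b≡m)
                 (evenColumnIsΦ-suc m odd a (suc b) (trans (ℕ.+-suc a b) (cong suc a+b≡m))) ⟩
  Ω a b (+ 1) + Φ a (suc b) (+ 1)
    ≡⟨ ℤ.+-comm (Ω a b (+ 1)) (Φ a (suc b) (+ 1)) ⟩
  Φ a (suc b) (+ 1) + Ω a b (+ 1)
    ≡⟨ Φ-suc a b (+ 1) ⟨
  Φ (suc a) b (+ 1) ∎
  where
  a+b≡m : a ℕ.+ b ≡ m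
  a+b≡m = ℕ.suc-injective 1+a+b≡1+m

evenColumnIsΦ : ∀ m → EvenColumnIsΦ m
evenColumnIsΦ zero    zero zero refl = refl
evenColumnIsΦ (suc m) = evenColumnIsΦ-suc m (oddColumnIsΩ m (evenColumnIsΦ m))

H≡F̃-at-1 : ∀ n → + H (suc n) ≡ F̃ (suc n) (+ 1)
H≡F̃-at-1 n = begin
  + g 1 (2 ℕ.* suc n)    ≡⟨ cong (λ k → + seidelCol k 1) (ℕ.*-suc 2 n) ⟩
  + evenColumn n 1       ≡⟨ evenColumnIsΦ n n 0 (ℕ.+-identityʳ n) ⟩
  Φ n 0 (+ 1)            ≡⟨ F̃≗Φ n (+ 1) ⟨
  F̃ (suc n) (+ 1)        ∎

stirling1-vanishing : ∀ a {m j} → m < j → stirling1 a m j ≡ + 0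
stirling1-vanishing a {zero}  {suc j} m<j       = refl
stirling1-vanishing a {suc m} {suc j} (s≤s m<j)
  rewrite stirling1-vanishing a m<j | stirling1-vanishing a (ℕ.m≤n⇒m≤1+n m<j) = identity (a m)
  where
  identity : ∀ A → + 0 - A * + 0 ≡ + 0
  identity = solve-∀

unsignedStirling1 : (ℕ → ℤ) → ℕ → ℕ → ℤ
unsignedStirling1 a m j = -1ℤ ^ (m ℕ.+ j) * stirling1 a m j

unsignedStirling1-zero : ∀ a m → unsignedStirling1 a (suc m) 0 ≡ a m * unsignedStirling1 a m 0
unsignedStirling1-zero a m = identity (-1ℤ ^ (m ℕ.+ 0)) (a m) (stirling1 a m 0)
  where
  identity : ∀ p A t → -1ℤ * p * - (A * t) ≡ A * (p * t)
  identity = solve-∀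

unsignedStirling1-suc : ∀ a m j →
  unsignedStirling1 a (suc m) (suc j) ≡ unsignedStirling1 a m j + a m * unsignedStirling1 a m (suc j)
unsignedStirling1-suc a m j = begin
  -1ℤ ^ (suc m ℕ.+ suc j) * (t₀ - a m * t₁)
    ≡⟨ cong (λ k → -1ℤ ^ suc k * (t₀ - a m * t₁)) (ℕ.+-suc m j) ⟩
  -1ℤ * (-1ℤ * p) * (t₀ - a m * t₁)
    ≡⟨ identity p (a m) t₀ t₁ ⟩
  p * t₀ + a m * (-1ℤ * p * t₁)
    ≡⟨ cong (λ k → p * t₀ + a m * (-1ℤ ^ k * t₁)) (ℕ.+-suc m j) ⟨
  p * t₀ + a m * (-1ℤ ^ (m ℕ.+ suc j) * t₁) ∎
  where
  p = -1ℤ ^ (m ℕ.+ j)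
  t₀ = stirling1 a m j
  t₁ = stirling1 a m (suc j)
  identity : ∀ p A t₀ t₁ → -1ℤ * (-1ℤ * p) * (t₀ - A * t₁) ≡ p * t₀ + A * (-1ℤ * p * t₁)
  identity = solve-∀

sumℤ-cong : ∀ m {f h : ℕ → ℤ} → (∀ j → f j ≡ h j) → sumℤ m f ≡ sumℤ m h
sumℤ-cong zero    f≡h = f≡h 0
sumℤ-cong (suc m) f≡h = cong₂ _+_ (sumℤ-cong m f≡h) (f≡h (suc m))

sumℤ-+ : ∀ m (f h : ℕ → ℤ) → sumℤ m (λ j → f j + h j) ≡ sumℤ m f + sumℤ m h
sumℤ-+ zero    f h = refl
sumℤ-+ (suc m) f h = trans (cong (_+ (f (suc m) + h (suc m))) (sumℤ-+ m f h))
  (+-interchange (sumℤ m f) (sumℤ m h) (f (suc m)) (h (suc m)))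

sumℤ-*ˡ : ∀ m c (f : ℕ → ℤ) → sumℤ m (λ j → c * f j) ≡ c * sumℤ m f
sumℤ-*ˡ zero    c f = refl
sumℤ-*ˡ (suc m) c f = trans (cong (_+ c * f (suc m)) (sumℤ-*ˡ m c f))
  (sym (ℤ.*-distribˡ-+ c (sumℤ m f) (f (suc m))))

sumℤ-suc-head : ∀ m (f : ℕ → ℤ) → sumℤ (suc m) f ≡ f 0 + sumℤ m (λ j → f (suc j))
sumℤ-suc-head zero    f = refl
sumℤ-suc-head (suc m) f = trans (cong (_+ f (suc (suc m))) (sumℤ-suc-head m f))
  (ℤ.+-assoc (f 0) (sumℤ m (λ j → f (suc j))) (f (suc (suc m))))

stirlingTransform : (ℕ → ℤ) → ℕ → (ℕ → ℤ) → ℤ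
stirlingTransform a m h = sumℤ m (λ j → unsignedStirling1 a m j * h j)

stirlingTransform-suc : ∀ a m h →
  stirlingTransform a (suc m) h
    ≡ stirlingTransform a m (λ j → h (suc j)) + a m * stirlingTransform a m h
stirlingTransform-suc a m h = begin
  stirlingTransform a (suc m) h
    ≡⟨ sumℤ-suc-head m (λ j → s (suc m) j * h j) ⟩
  s (suc m) 0 * h 0 + sumℤ m (λ j → s (suc m) (suc j) * h (suc j))
    ≡⟨ cong₂ _+_ (trans (cong (_* h 0) (unsignedStirling1-zero a m)) (ℤ.*-assoc (a m) (s m 0) (h 0)))
                 (sumℤ-cong m split) ⟩
  a m * (s m 0 * h 0) + sumℤ m (λ j → s m j * h (suc j) + a m * (s m (suc j) * h (suc j)))
    ≡⟨ cong (λ t → a m * (s m 0 * h 0) + t)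
         (trans (sumℤ-+ m _ _) (cong (λ t → stirlingTransform a m (λ j → h (suc j)) + t) (sumℤ-*ˡ m (a m) _))) ⟩
  a m * (s m 0 * h 0) + (stirlingTransform a m (λ j → h (suc j)) + a m * tail)
    ≡⟨ identity (a m) (s m 0 * h 0) (stirlingTransform a m (λ j → h (suc j))) tail ⟩
  stirlingTransform a m (λ j → h (suc j)) + a m * (s m 0 * h 0 + tail)
    ≡⟨ cong (λ t → stirlingTransform a m (λ j → h (suc j)) + a m * t) extend ⟩
  stirlingTransform a m (λ j → h (suc j)) + a m * stirlingTransform a m h ∎
  where
  s = unsignedStirling1 a
  tail = sumℤ m (λ j → s m (suc j) * h (suc j))
  split : ∀ j → s (suc m) (suc j) * h (suc j) ≡ s m j * h (suc j) + a m * (s m (suc j) * h (suc j))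
  split j = trans (cong (_* h (suc j)) (unsignedStirling1-suc a m j))
    (trans (ℤ.*-distribʳ-+ (h (suc j)) (s m j) (a m * s m (suc j)))
           (cong (λ t → s m j * h (suc j) + t) (ℤ.*-assoc (a m) (s m (suc j)) (h (suc j)))))
  identity : ∀ A x y t → A * x + (y + A * t) ≡ y + A * (x + t)
  identity = solve-∀
  -- the extra term is s m (suc m) = 0
  extend : s m 0 * h 0 + tail ≡ stirlingTransform a m h
  extend = begin
    s m 0 * h 0 + tail
      ≡⟨ sumℤ-suc-head m (λ j → s m j * h j) ⟨
    stirlingTransform a m h + s m (suc m) * h (suc m)
      ≡⟨ cong (λ t → stirlingTransform a m h + -1ℤ ^ (m ℕ.+ suc m) * t * h (suc m))
              (stirling1-vanishing a (ℕ.n<1+n m)) ⟩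
    stirlingTransform a m h + -1ℤ ^ (m ℕ.+ suc m) * + 0 * h (suc m)
      ≡⟨ cong (λ t → stirlingTransform a m h + t * h (suc m)) (ℤ.*-zeroʳ (-1ℤ ^ (m ℕ.+ suc m))) ⟩
    stirlingTransform a m h + + 0
      ≡⟨ ℤ.+-identityʳ _ ⟩
    stirlingTransform a m h ∎

stirlingTransform-solves : ∀ a (X : ℕ → ℕ → ℤ) →
  (∀ n m → X n (suc m) ≡ X (suc n) m + a m * X n m) →
  ∀ m n → stirlingTransform a m (λ j → X (n ℕ.+ j) 0) ≡ X n m
stirlingTransform-solves a X X-rec zero n =
  trans (ℤ.*-identityˡ (X (n ℕ.+ 0) 0)) (cong (λ k → X k 0) (ℕ.+-identityʳ n))
stirlingTransform-solves a X X-rec (suc m) n = begin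
  stirlingTransform a (suc m) (λ j → X (n ℕ.+ j) 0)
    ≡⟨ stirlingTransform-suc a m (λ j → X (n ℕ.+ j) 0) ⟩
  stirlingTransform a m (λ j → X (n ℕ.+ suc j) 0) + a m * stirlingTransform a m (λ j → X (n ℕ.+ j) 0)
    ≡⟨ cong₂ (λ u v → u + a m * v)
         (trans (sumℤ-cong m (λ j → cong (λ k → unsignedStirling1 a m j * X k 0) (ℕ.+-suc n j)))
                (stirlingTransform-solves a X X-rec m (suc n)))
         (stirlingTransform-solves a X X-rec m n) ⟩
  X (suc n) m + a m * X n m
    ≡⟨ X-rec n m ⟨
  X n (suc m) ∎

factorial-product-suc : ∀ m → suc m ! ℕ.* suc (suc m) ! ≡ (suc m ℕ.* suc (suc m)) ℕ.* (m ! ℕ.* suc m !)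
factorial-product-suc m = identity m (m !) (suc m !)
  where
  identity : ∀ m x y → (suc m ℕ.* x) ℕ.* (suc (suc m) ℕ.* y) ≡ (suc m ℕ.* suc (suc m)) ℕ.* (x ℕ.* y)
  identity = ℕ-solve-∀

F̃-scaled : ℕ → ℕ → ℤ
F̃-scaled n m = F̃ (suc n) (+ suc m) * + (m ! ℕ.* suc m !)

F̃-scaled-rec : ∀ n m → F̃-scaled n (suc m) ≡ F̃-scaled (suc n) m + + (m ℕ.* suc m) * F̃-scaled n m
F̃-scaled-rec n m = begin
  F (+ suc (suc m)) * + (suc m ! ℕ.* suc (suc m) !)
    ≡⟨ cong (λ k → F (+ suc (suc m)) * + k) (factorial-product-suc m) ⟩
  F (+ suc (suc m)) * + ((suc m ℕ.* suc (suc m)) ℕ.* (m ! ℕ.* suc m !))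
    ≡⟨ cong (F (+ suc (suc m)) *_) (trans (ℤ.pos-* (suc m ℕ.* suc (suc m)) (m ! ℕ.* suc m !)) (cong (_* P) (ℤ.pos-* (suc m) (suc (suc m))))) ⟩
  F (+ suc (suc m)) * (z * + suc (suc m) * P)
    ≡⟨ cong (λ w → F w * (z * w * P)) (cong (λ k → + suc k) (ℕ.+-comm 1 m)) ⟩
  F (z + + 1) * (z * (z + + 1) * P)
    ≡⟨ identity z (F z) (F (z + + 1)) P ⟨
  ℓ F z * P + (z - + 1) * z * (F z * P)
    ≡⟨ cong (λ A → ℓ F z * P + A * (F z * P)) (ℤ.pos-* m (suc m)) ⟨
  F̃-scaled (suc n) m + + (m ℕ.* suc m) * F̃-scaled n m ∎
  where
  F = F̃ (suc n)
  z = + suc m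
  P = + (m ! ℕ.* suc m !)
  identity : ∀ z F₀ F₁ P →
    (z * (z + + 1) * F₁ - (z - + 1) * z * F₀) * P + (z - + 1) * z * (F₀ * P) ≡ F₁ * (z * (z + + 1) * P)
  identity = solve-∀

proposition3 : (n m : ℕ) → 1 ≤ n →
    sumℤ m (λ j → (-1ℤ ^ (m ℕ.+ j)) * Ls m j * + H (n ℕ.+ j))
      ≡ F̃ n (+ suc m) * + (m ! ℕ.* (suc m) !)
proposition3 (suc n) m _ = begin
  stirlingTransform LsSequence m (λ j → + H (suc n ℕ.+ j))
    ≡⟨ sumℤ-cong m (λ j → cong (unsignedStirling1 LsSequence m j *_) (H-scaled (n ℕ.+ j))) ⟩
  stirlingTransform LsSequence m (λ j → F̃-scaled (n ℕ.+ j) 0)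
    ≡⟨ stirlingTransform-solves LsSequence F̃-scaled F̃-scaled-rec m n ⟩
  F̃-scaled n m ∎
  where
  LsSequence : ℕ → ℤ
  LsSequence k = + (k ℕ.* suc k)
  H-scaled : ∀ k → + H (suc k) ≡ F̃-scaled k 0
  H-scaled k = trans (H≡F̃-at-1 k) (sym (ℤ.*-identityʳ _))
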